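{- Let $d\ge 2$. For all integers $n \ge 1$ and $1 \le t < 2d$ and every $t$-approximation $A$ in $\mathbb{Z}^d$, the number of regular odd sets $S\subset \mathbb{Z}^d$ with $|\partial S|=n$ that are approximated by $A$ is at most $2^{n/(2d-t)}$.
   Context: $\mathbb{Z}^d$ is viewed as a graph with nearest-neighbor adjacency. A vertex is odd (even) if its graph distance from the origin is odd (even). $\partial S$ is the set of edges with exactly one endpoint in $S$. A set $U$ is odd (resp. even) if every vertex of $U$ adjacent to a vertex outside $U$ is odd (resp. even). A set is regular if neither it nor its complement contains a vertex all of whose neighbors lie outside it. An approximation is a pair $A=(A_\bullet,A_\circ)$ of disjoint subsets of $\mathbb{Z}^d$ with $A_\bullet$ odd and $A_\circ$ even; set $A_*:=(A_\bullet\cup A_\circ)^c$. $A$ approximates a set $S$ if $A_\bullet\subset S$ and $A_\circ\subset S^c$. For an integer $1\le t<2d$, a $t$-approximation is an approximation such that the subgraph of $\mathbb{Z}^d$ induced by $A_*$ has maximum degree at most $t$ and has no isolated vertices. -}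

module Defs where

open import Data.Nat using (ℕ; _%_; _≤_; _+_)
open import Data.Integer using (ℤ; ∣_∣; _-_; 1ℤ) renaming (_+_ to _+ℤ_)
open import Data.Fin using (Fin)
open import Data.Vec using (Vec; updateAt; toList)
import Data.Vec as V
open import Data.List using (List; []; _∷_; _++_; length; filterᵇ; concatMap)
open import Data.List.Relation.Unary.All using (All)
open import Data.List.Relation.Unary.Unique.Propositional using (Unique)
open import Data.List.Membership.Propositional using (_∈_)
open import Data.List using (allFin)
open import Data.Bool using (Bool; true; false; not; _∧_)
open import Data.Product using (_×_; Σ; ∃; _,_)
open import Relation.Binary.PropositionalEquality using (_≡_; _≢_)
open import Relation.Nullary using (¬_)
open import Function.Bundles using (_⇔_)

Vertex : ℕ → Set
Vertex d = Vec ℤ d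

Subset : ℕ → Set
Subset d = Vertex d → Bool

_∈S_ : ∀ {d} → Vertex d → Subset d → Set
x ∈S S = S x ≡ true

_∉S_ : ∀ {d} → Vertex d → Subset d → Set
x ∉S S = S x ≡ false

complement : ∀ {d} → Subset d → Subset d
complement S x = not (S x)

_+e_ : ∀ {d} → Vertex d → Fin d → Vertex d
x +e i = updateAt x i (λ a → a +ℤ 1ℤ)

_-e_ : ∀ {d} → Vertex d → Fin d → Vertex d
x -e i = updateAt x i (λ a → a - 1ℤ)

neighbours : ∀ {d} → Vertex d → List (Vertex d)
neighbours {d} x = concatMap (λ i → (x +e i) ∷ (x -e i) ∷ []) (allFin d)

Adjacent : ∀ {d} → Vertex d → Vertex d → Set
Adjacent x y = y ∈ neighbours x

distFromOrigin : ∀ {d} → Vertex d → ℕ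
distFromOrigin x = V.sum (V.map ∣_∣ x)

OddVertex : ∀ {d} → Vertex d → Set
OddVertex x = distFromOrigin x % 2 ≡ 1

EvenVertex : ∀ {d} → Vertex d → Set
EvenVertex x = distFromOrigin x % 2 ≡ 0

OddSet : ∀ {d} → Subset d → Set
OddSet {d} U = ∀ (x y : Vertex d) → x ∈S U → Adjacent x y → y ∉S U → OddVertex x

EvenSet : ∀ {d} → Subset d → Set
EvenSet {d} U = ∀ (x y : Vertex d) → x ∈S U → Adjacent x y → y ∉S U → EvenVertex x

NoIsolatedInside : ∀ {d} → Subset d → Set
NoIsolatedInside {d} U = ¬ (Σ (Vertex d) λ x → x ∈S U × All (λ y → y ∉S U) (neighbours x))

Regular : ∀ {d} → Subset d → Set
Regular S = NoIsolatedInside S × NoIsolatedInside (complement S)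

-- Edges of ℤ^d: the pair (x , i) encodes the edge {x , x + e_i} (each edge exactly once).
Edge : ℕ → Set
Edge d = Vertex d × Fin d

InBoundary : ∀ {d} → Subset d → Edge d → Set
InBoundary S (x , i) = S x ≢ S (x +e i)

BoundarySize : ∀ {d} → Subset d → ℕ → Set
BoundarySize {d} S n =
  Σ (List (Edge d)) λ L → Unique L × length L ≡ n × (∀ e → (e ∈ L) ⇔ InBoundary S e)

record Approximation (d : ℕ) : Set where
  field
    black : Subset d
    white : Subset d
    disjoint : ∀ x → ¬ (x ∈S black × x ∈S white)
    blackOdd : OddSet black
    whiteEven : EvenSet white

open Approximation public

star : ∀ {d} → Approximation d → Subset d
star A x = not (black A x) ∧ not (white A x)

Approximates : ∀ {d} → Approximation d → Subset d → Set
Approximates {d} A S = (∀ (x : Vertex d) → x ∈S black A → x ∈S S)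
                     × (∀ (x : Vertex d) → x ∈S white A → x ∉S S)

degreeIn : ∀ {d} → Subset d → Vertex d → ℕ
degreeIn U x = length (filterᵇ U (neighbours x))

IsTApproximation : ∀ {d} → ℕ → Approximation d → Set
IsTApproximation {d} t A = ∀ (x : Vertex d) → x ∈S star A → 1 ≤ degreeIn (star A) x × degreeIn (star A) x ≤ t

module Submission where

-- Fix a t-approximation A and put m = 2d − t.  For a regular odd set S
-- approximated by A, its code C(S) is the set of vertices x of A* lying on
-- the parity-appropriate side of S: x odd and x ∈ S, or x even and x ∉ S.
--   * C(S) is a minimal vertex cover of the graph induced on A*: of two
--     adjacent vertices one is odd, and oddness of S forces one of them into
--     C(S); regularity of S provides, for each x ∈ C(S), a neighbour in A*
--     outside C(S).
--   * S is determined by C(S), since A fixes S outside A*.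
--   * Each x ∈ C(S) has at least m neighbours outside A*, and every such
--     edge lies in ∂S; these edges are distinct for distinct x, so
--     m · |C(S)| ≤ |∂S| = n.
-- An abstract lemma says that a graph has at most 2^r minimal vertex covers
-- of size ≤ r (branch on the two ends of an edge, r times).  With r = ⌊n/m⌋
-- the number N of sets satisfies N ≤ 2^⌊n/m⌋, hence N^m ≤ 2^n.

open import Defs
open import Data.Nat using (ℕ; zero; suc; _+_; _*_; _∸_; _^_; _≤_; _<_; z≤n; s≤s; NonZero; >-nonZero; _/_; _%_)
open import Data.Nat.Properties
  using (+-suc; +-comm; +-identityʳ; *-suc; *-comm; *-zeroʳ; +-mono-≤; ≤-trans; ≤-refl; ≤-reflexive;
         1+n≰n; _≤?_; m+n∸m≡n; ∸-monoʳ-≤; ∸-monoˡ-≤; m^n>0; ^-monoˡ-≤; ^-monoʳ-≤; ^-*-assoc;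
         m<n⇒0<n∸m; module ≤-Reasoning)
open import Data.Nat.DivMod using (m/n*n≤m; m*n/n≡m; /-monoˡ-≤; [m+n]%n≡m%n)
open import Data.Integer using (ℤ; +_; -[1+_]; ∣_∣; 1ℤ)
import Data.Integer as ℤ
import Data.Integer.Properties as ℤP
open import Data.Fin using (Fin) renaming (zero to fzero; suc to fsuc)
open import Data.Vec using (_∷_)
import Data.Vec as Vec
open import Data.List using (List; []; _∷_; _++_; length; filterᵇ; concatMap; allFin)
import Data.List as List
open import Data.List.Properties using (length-++; length-++-sucʳ; length-map; length-tabulate; map-concatMap)
open import Data.List.Relation.Unary.All using (All; []; _∷_)
import Data.List.Relation.Unary.All as All
import Data.List.Relation.Unary.All.Properties as AllP
open import Data.List.Relation.Unary.Any using (Any; here; there)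
import Data.List.Relation.Unary.Any as Any
open import Data.List.Relation.Unary.AllPairs using (AllPairs; []; _∷_)
import Data.List.Relation.Unary.AllPairs.Properties as AllPairsP
open import Data.List.Relation.Unary.Unique.Propositional using (Unique)
import Data.List.Relation.Unary.Unique.Propositional.Properties as UniqueP
open import Data.List.Membership.Propositional using (_∈_; _∉_)
open import Data.List.Membership.Propositional.Properties
  using (∈-∃++; ∈-map⁻; ∈-filter⁻; ∈-concatMap⁻; ∈-concatMap⁺; ∈-allFin)
open import Data.Bool using (Bool; true; false; not; _∧_; if_then_else_; T)
open import Data.Bool.Properties using (not-involutive; not-injective; ∧-zeroʳ) renaming (_≟_ to _≟ᵇ_)
open import Data.Product using (_×_; Σ; _,_; proj₁; proj₂)
open import Data.Sum using (_⊎_; inj₁; inj₂; swap)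
import Data.Sum
open import Data.Empty using (⊥-elim)
open import Data.Unit using (⊤; tt)
open import Function using (_∘_)
open import Function.Bundles using (Equivalence)
open import Relation.Binary.PropositionalEquality
open import Relation.Nullary using (¬_)
open import Relation.Nullary.Decidable using (T?; decidable-stable)

bool-cases : (b : Bool) → b ≡ true ⊎ b ≡ false
bool-cases true  = inj₁ refl
bool-cases false = inj₂ refl

true≢false : true ≢ false
true≢false ()

≢⇒not : ∀ {c} b → c ≢ b → c ≡ not b
≢⇒not {true}  true  c≢b = ⊥-elim (c≢b refl)
≢⇒not {true}  false c≢b = refl
≢⇒not {false} true  c≢b = refl
≢⇒not {false} false c≢b = ⊥-elim (c≢b refl)

T⇒true : ∀ {b} → T b → b ≡ true
T⇒true {true} _ = refl

length-filter-split : ∀ {A : Set} (p : A → Bool) xs →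
  length (filterᵇ p xs) + length (filterᵇ (not ∘ p) xs) ≡ length xs
length-filter-split p [] = refl
length-filter-split p (x ∷ xs) with p x
... | true  = cong suc (length-filter-split p xs)
... | false = trans (+-suc _ _) (cong suc (length-filter-split p xs))

length-filter-map : ∀ {A B : Set} (f : A → B) (q : B → Bool) xs →
  length (filterᵇ (q ∘ f) xs) ≡ length (filterᵇ q (List.map f xs))
length-filter-map f q [] = refl
length-filter-map f q (x ∷ xs) with q (f x)
... | true  = cong suc (length-filter-map f q xs)
... | false = length-filter-map f q xs

unique-map-filter : ∀ {A B : Set} (f : A → B) (q : A → Bool) xs →
  Unique (List.map f xs) → Unique (List.map f (filterᵇ q xs))
unique-map-filter f q [] _ = []
unique-map-filter f q (x ∷ xs) (fx∉ ∷ u) with q x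
... | true  = AllP.map⁺ (AllP.filter⁺ (T? ∘ q) (AllP.map⁻ fx∉)) ∷ unique-map-filter f q xs u
... | false = unique-map-filter f q xs u

unique-⊆-length : ∀ {A : Set} (xs ys : List A) → Unique xs → All (_∈ ys) xs → length xs ≤ length ys
unique-⊆-length [] ys _ _ = z≤n
unique-⊆-length (x ∷ xs) ys (x∉ ∷ u) (x∈ys ∷ xs⊆ys) with ∈-∃++ x∈ys
... | ys₁ , ys₂ , refl =
  subst (suc (length xs) ≤_) (sym (length-++-sucʳ ys₁ x ys₂))
    (s≤s (unique-⊆-length xs (ys₁ ++ ys₂) u
      (All.zipWith (λ (x≢z , z∈) → remove ys₁ x≢z z∈) (x∉ , xs⊆ys))))
  where
  remove : ∀ ys₁ {z ys₂} → x ≢ z → z ∈ ys₁ ++ x ∷ ys₂ → z ∈ ys₁ ++ ys₂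
  remove []        x≢z (here z≡x)  = ⊥-elim (x≢z (sym z≡x))
  remove []        x≢z (there z∈)  = z∈
  remove (_ ∷ ys₁) x≢z (here z≡y)  = here z≡y
  remove (_ ∷ ys₁) x≢z (there z∈)  = there (remove ys₁ x≢z z∈)

allPairs-restrict : ∀ {A : Set} {P : A → Set} {R R′ : A → A → Set} {xs} →
  (∀ {x y} → P x → P y → R x y → R′ x y) → All P xs → AllPairs R xs → AllPairs R′ xs
allPairs-restrict h [] [] = []
allPairs-restrict h (px ∷ ps) (rx ∷ rs) =
  All.zipWith (λ (py , r) → h px py r) (ps , rx) ∷ allPairs-restrict h ps rs

unique-concatMap : ∀ {A B : Set} {P : A → Set} (f : A → List B) {xs} → Unique xs → All P xs →
  (∀ {x} → P x → Unique (f x)) →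
  (∀ {x x′ e} → P x → P x′ → e ∈ f x → e ∈ f x′ → x ≡ x′) →
  Unique (concatMap f xs)
unique-concatMap {P = P} f u ps unique-block same-block =
  UniqueP.concat⁺ (AllP.map⁺ (All.map unique-block ps))
    (AllPairsP.map⁺ (allPairs-restrict blocks-disjoint ps u))
  where
  blocks-disjoint : ∀ {x x′} → P x → P x′ → x ≢ x′ → ∀ {e} → ¬ (e ∈ f x × e ∈ f x′)
  blocks-disjoint px px′ x≢x′ (e∈ , e∈′) = x≢x′ (same-block px px′ e∈ e∈′)

length-concatMap-≥ : ∀ {A B : Set} m (f : A → List B) xs →
  All (λ x → m ≤ length (f x)) xs → m * length xs ≤ length (concatMap f xs)
length-concatMap-≥ m f [] [] = ≤-reflexive (*-zeroʳ m)
length-concatMap-≥ m f (x ∷ xs) (m≤fx ∷ bounds) =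
  subst₂ _≤_ (sym (*-suc m (length xs))) (sym (length-++ (f x)))
    (+-mono-≤ m≤fx (length-concatMap-≥ m f xs bounds))

module MinimalVertexCovers {V : Set} (E : V → V → Set) where

  -- c meets every edge, and every vertex of c has an out-neighbour outside c.
  -- Minimality is stated classically (double negation), as it is used.
  record IsMinimalCover (c : V → Bool) : Set where
    field
      covers  : ∀ x y → E x y → c x ≡ true ⊎ c y ≡ true
      minimal : ∀ x → c x ≡ true → ¬ ¬ (Σ V λ y → E x y × c y ≡ false)

  Contains : (V → Bool) → List V → Set
  Contains c P = All (λ x → c x ≡ true) P

  HasAtMost : ℕ → (V → Bool) → Set
  HasAtMost r c = ∀ P → Unique P → Contains c P → length P ≤ r

  Distinct : (V → Bool) → (V → Bool) → Set
  Distinct c c′ = ¬ (∀ x → c x ≡ c′ x)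

  Member : ℕ → List V → (V → Bool) → Set
  Member r P c = IsMinimalCover c × HasAtMost r c × Contains c P

  separate : ∀ {c c′} → Distinct c c′ →
    ¬ ¬ (Σ V λ x → (c x ≡ true × c′ x ≡ false) ⊎ (c′ x ≡ true × c x ≡ false))
  separate {c} {c′} c≠c′ ¬sep =
    c≠c′ λ x → decidable-stable (c x ≟ᵇ c′ x) (λ ne → ¬sep (x , orient x ne))
    where
    orient : ∀ x → c x ≢ c′ x → (c x ≡ true × c′ x ≡ false) ⊎ (c′ x ≡ true × c x ≡ false)
    orient x ne with c x | c′ x
    ... | true  | true  = ⊥-elim (ne refl)
    ... | true  | false = inj₁ (refl , refl)
    ... | false | true  = inj₂ (refl , refl)
    ... | false | false = ⊥-elim (ne refl)

  ∉-common : ∀ {c P x} → Contains c P → c x ≡ false → x ∉ P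
  ∉-common c⊇P cx≡false x∈P = true≢false (trans (sym (All.lookup c⊇P x∈P)) cx≡false)

  fresh-unique : ∀ {x : V} {P} → Unique P → x ∉ P → Unique (x ∷ P)
  fresh-unique {P = P} u x∉P = All.tabulate (λ y∈P x≡y → x∉P (subst (_∈ P) (sym x≡y) y∈P)) ∷ u

  covers-≤ : ∀ r k P F → Unique P → r ≤ length P + k →
    AllPairs Distinct F → All (Member r P) F → length F ≤ 2 ^ k

  -- Given x ∈ a \ b: if k = 0, a ⊇ x ∷ P is too big; otherwise take an edge x → y
  -- leaving a, split F into the members containing x and those (containing y) that do not,
  -- and recurse on both halves with P extended.
  branch : ∀ r k P F → Unique P → r ≤ length P + k →
    AllPairs Distinct F → All (Member r P) F →
    ∀ {a b} x → Member r P a → Contains b P → a x ≡ true → b x ≡ false → ¬ ¬ (length F ≤ 2 ^ k)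

  covers-≤ r k P [] _ _ _ _ = z≤n
  covers-≤ r k P (_ ∷ []) _ _ _ _ = m^n>0 2 k
  covers-≤ r k P F@(c₁ ∷ c₂ ∷ _) u bound distinct@((c₁≠c₂ ∷ _) ∷ _) members@(m₁ ∷ m₂ ∷ _) =
    decidable-stable (length F ≤? 2 ^ k) λ too-many → separate c₁≠c₂ λ where
      (x , inj₁ (c₁x , c₂x)) → branch-at x m₁ m₂ c₁x c₂x too-many
      (x , inj₂ (c₂x , c₁x)) → branch-at x m₂ m₁ c₂x c₁x too-many
    where
    branch-at : ∀ {a b} x → Member r P a → Member r P b → a x ≡ true → b x ≡ false → ¬ ¬ (length F ≤ 2 ^ k)
    branch-at x ma (_ , _ , b⊇P) = branch r k P F u bound distinct members x ma b⊇P

  branch r zero P F u bound _ _ x (_ , small , a⊇P) b⊇P ax bx _ =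
    1+n≰n (≤-trans (small (x ∷ P) (fresh-unique u (∉-common b⊇P bx)) (ax ∷ a⊇P))
                   (≤-trans bound (≤-reflexive (+-identityʳ (length P)))))
  branch r (suc k) P F u bound distinct members {a = a} x (cover , _ , a⊇P) b⊇P ax bx too-many =
    IsMinimalCover.minimal cover x ax λ (y , x→y , ay) → too-many (begin
      length F                                       ≡⟨ sym (length-filter-split hasX F) ⟩
      length containing-x + length avoiding-x        ≤⟨ +-mono-≤ containing-x-≤ (avoiding-x-≤ x→y ay) ⟩
      2 ^ k + 2 ^ k                                  ≡⟨ cong (λ n → 2 ^ k + n) (sym (+-identityʳ (2 ^ k))) ⟩
      2 ^ suc k                                      ∎)
    where
    open ≤-Reasoning
    hasX : (V → Bool) → Bool
    hasX c = c x
    containing-x avoiding-x : List (V → Bool)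
    containing-x = filterᵇ hasX F
    avoiding-x   = filterᵇ (not ∘ hasX) F
    bound′ : r ≤ suc (length P) + k
    bound′ = ≤-trans bound (≤-reflexive (+-suc (length P) k))
    containing-x-≤ : length containing-x ≤ 2 ^ k
    containing-x-≤ =
      covers-≤ r k (x ∷ P) containing-x (fresh-unique u (∉-common b⊇P bx)) bound′
        (AllPairsP.filter⁺ (T? ∘ hasX) distinct)
        (All.zipWith (λ (tx , (cv , sm , c⊇P)) → cv , sm , T⇒true tx ∷ c⊇P)
          (AllP.all-filter (T? ∘ hasX) F , AllP.filter⁺ (T? ∘ hasX) members))
    -- The members avoiding x cover the edge x → y at y, so they contain y ∷ P.
    avoiding-x-≤ : ∀ {y} → E x y → a y ≡ false → length avoiding-x ≤ 2 ^ k
    avoiding-x-≤ {y} x→y ay =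
      covers-≤ r k (y ∷ P) avoiding-x (fresh-unique u (∉-common a⊇P ay)) bound′
        (AllPairsP.filter⁺ (T? ∘ not ∘ hasX) distinct)
        (All.zipWith (λ (tx , (cv , sm , c⊇P)) → cv , sm , y-in cv (not-injective (T⇒true tx)) ∷ c⊇P)
          (AllP.all-filter (T? ∘ not ∘ hasX) F , AllP.filter⁺ (T? ∘ not ∘ hasX) members))
      where
      y-in : ∀ {c} → IsMinimalCover c → c x ≡ false → c y ≡ true
      y-in cv cx with IsMinimalCover.covers cv x y x→y
      ... | inj₁ cx′ = ⊥-elim (true≢false (trans (sym cx′) cx))
      ... | inj₂ cy  = cy

  minimal-covers-≤ : ∀ r F → AllPairs Distinct F →
    All (λ c → IsMinimalCover c × HasAtMost r c) F → length F ≤ 2 ^ r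
  minimal-covers-≤ r F distinct covers =
    covers-≤ r r [] F [] ≤-refl distinct (All.map (λ (cv , sm) → cv , sm , []) covers)

suc-pred : ∀ (a : ℤ) → (a ℤ.+ 1ℤ) ℤ.- 1ℤ ≡ a
suc-pred a = trans (ℤP.+-assoc a 1ℤ (ℤ.- 1ℤ)) (ℤP.+-identityʳ a)

pred-suc : ∀ (a : ℤ) → (a ℤ.- 1ℤ) ℤ.+ 1ℤ ≡ a
pred-suc a = trans (ℤP.+-assoc a (ℤ.- 1ℤ) 1ℤ) (ℤP.+-identityʳ a)

∣suc∣ : ∀ (a : ℤ) → ∣ a ℤ.+ 1ℤ ∣ ≡ suc ∣ a ∣ ⊎ ∣ a ∣ ≡ suc ∣ a ℤ.+ 1ℤ ∣
∣suc∣ (+ n)          = inj₁ (+-comm n 1)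
∣suc∣ -[1+ zero ]    = inj₂ refl
∣suc∣ -[1+ suc n ]   = inj₂ refl

+e-e : ∀ {d} (x : Vertex d) i → (x +e i) -e i ≡ x
+e-e (a ∷ x) fzero    = cong (_∷ x) (suc-pred a)
+e-e (a ∷ x) (fsuc i) = cong (a ∷_) (+e-e x i)

-e+e : ∀ {d} (x : Vertex d) i → (x -e i) +e i ≡ x
-e+e (a ∷ x) fzero    = cong (_∷ x) (pred-suc a)
-e+e (a ∷ x) (fsuc i) = cong (a ∷_) (-e+e x i)

≢-e : ∀ {d} (x : Vertex d) i → x ≢ x -e i
≢-e (a ∷ x) fzero    eq = ℤP.i≢suc[i] (sym (trans (ℤP.+-comm 1ℤ (a ℤ.- 1ℤ))
                                                (trans (pred-suc a) (cong Vec.head eq))))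
≢-e (a ∷ x) (fsuc i) eq = ≢-e x i (cong Vec.tail eq)

dist-step : ∀ {d} (x : Vertex d) i →
  distFromOrigin (x +e i) ≡ suc (distFromOrigin x) ⊎ distFromOrigin x ≡ suc (distFromOrigin (x +e i))
dist-step (a ∷ x) fzero with ∣suc∣ a
... | inj₁ eq = inj₁ (cong (_+ distFromOrigin x) eq)
... | inj₂ eq = inj₂ (cong (_+ distFromOrigin x) eq)
dist-step (a ∷ x) (fsuc i) with dist-step x i
... | inj₁ eq = inj₁ (trans (cong (λ r → ∣ a ∣ + r) eq) (+-suc _ _))
... | inj₂ eq = inj₂ (trans (cong (λ r → ∣ a ∣ + r) eq) (+-suc _ _))

module _ {d : ℕ} where

  steps : Vertex d → Fin d → List (Vertex d)
  steps x i = (x +e i) ∷ (x -e i) ∷ []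

  +e-neighbour : ∀ (x : Vertex d) i → (x +e i) ∈ neighbours x
  +e-neighbour x i =
    ∈-concatMap⁺ (steps x) {xs = allFin d} (Any.map (λ { refl → here refl }) (∈-allFin i))

  -e-neighbour : ∀ (x : Vertex d) i → (x -e i) ∈ neighbours x
  -e-neighbour x i =
    ∈-concatMap⁺ (steps x) {xs = allFin d} (Any.map (λ { refl → there (here refl) }) (∈-allFin i))

  neighbour-cases : ∀ (x y : Vertex d) → y ∈ neighbours x → Σ (Fin d) λ i → y ≡ x +e i ⊎ y ≡ x -e i
  neighbour-cases x y y∈ = go (allFin d) (∈-concatMap⁻ (steps x) {xs = allFin d} y∈)
    where
    go : ∀ is → Any (λ i → y ∈ steps x i) is → Σ (Fin d) λ i → y ≡ x +e i ⊎ y ≡ x -e i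
    go (i ∷ is) (here (here eq))          = i , inj₁ eq
    go (i ∷ is) (here (there (here eq)))  = i , inj₂ eq
    go (i ∷ is) (there any)               = go is any

  adjacent-sym : ∀ (x y : Vertex d) → y ∈ neighbours x → x ∈ neighbours y
  adjacent-sym x y y∈ with neighbour-cases x y y∈
  ... | i , inj₁ refl = subst (_∈ neighbours (x +e i)) (+e-e x i) (-e-neighbour (x +e i) i)
  ... | i , inj₂ refl = subst (_∈ neighbours (x -e i)) (-e+e x i) (+e-neighbour (x -e i) i)

  length-neighbours : ∀ (x : Vertex d) → 2 * d ≤ length (neighbours x)
  length-neighbours x =
    subst (λ k → 2 * k ≤ length (neighbours x)) (length-tabulate {n = d} (λ i → i))
      (length-concatMap-≥ 2 (steps x) (allFin d) (All.tabulate (λ _ → ≤-refl)))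

odd? : ℕ → Bool
odd? zero    = false
odd? (suc n) = not (odd? n)

odd?-%2 : ∀ n → n % 2 ≡ (if odd? n then 1 else 0)
odd?-%2 0 = refl
odd?-%2 1 = refl
odd?-%2 (suc (suc n)) = begin
  (2 + n) % 2                             ≡⟨ cong (_% 2) (+-comm 2 n) ⟩
  (n + 2) % 2                             ≡⟨ [m+n]%n≡m%n n 2 ⟩
  n % 2                                   ≡⟨ odd?-%2 n ⟩
  (if odd? n then 1 else 0)               ≡⟨ cong (λ b → if b then 1 else 0) (sym (not-involutive (odd? n))) ⟩
  (if not (not (odd? n)) then 1 else 0)   ∎
  where open ≡-Reasoning

isOdd : ∀ {d} → Vertex d → Bool
isOdd x = odd? (distFromOrigin x)

odd-vertex : ∀ {d} (x : Vertex d) → OddVertex x → isOdd x ≡ true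
odd-vertex x odd with isOdd x | odd?-%2 (distFromOrigin x)
... | true  | _  = refl
... | false | eq with trans (sym odd) eq
... | ()

even-vertex : ∀ {d} (x : Vertex d) → EvenVertex x → isOdd x ≡ false
even-vertex x even with isOdd x | odd?-%2 (distFromOrigin x)
... | false | _  = refl
... | true  | eq with trans (sym even) eq
... | ()

not-swap : ∀ {a b} → a ≡ not b → b ≡ not a
not-swap {b = b} refl = sym (not-involutive b)

step-parity : ∀ {d} (x : Vertex d) i → isOdd (x +e i) ≡ not (isOdd x)
step-parity x i with dist-step x i
... | inj₁ eq = cong odd? eq
... | inj₂ eq = not-swap (cong odd? eq)

adjacent-parity : ∀ {d} (x y : Vertex d) → y ∈ neighbours x → isOdd y ≡ not (isOdd x)
adjacent-parity x y y∈ with neighbour-cases x y y∈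
... | i , inj₁ refl = step-parity x i
... | i , inj₂ refl = not-swap (subst (λ z → isOdd z ≡ not (isOdd (x -e i))) (-e+e x i) (step-parity (x -e i) i))

module Code {d : ℕ} (A : Approximation d) where

  StarEdge : Vertex d → Vertex d → Set
  StarEdge x y = y ∈ neighbours x × star A x ≡ true × star A y ≡ true

  open MinimalVertexCovers StarEdge public

  side : Subset d → Vertex d → Bool
  side S x = if isOdd x then S x else not (S x)

  code : Subset d → Subset d
  code S x = star A x ∧ side S x

  Admissible : Subset d → Set
  Admissible S = Regular S × OddSet S × Approximates A S

  -- A vertex on the side of S; `OnSide (complement S)` is the opposite side.
  data OnSide (S : Subset d) (x : Vertex d) : Set where
    odd-in   : isOdd x ≡ true  → S x ≡ true  → OnSide S x
    even-out : isOdd x ≡ false → S x ≡ false → OnSide S x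

  code-on : ∀ {S x} → star A x ≡ true → OnSide S x → code S x ≡ true
  code-on sx (odd-in ox Sx)   rewrite sx | ox | Sx = refl
  code-on sx (even-out ox Sx) rewrite sx | ox | Sx = refl

  code-off : ∀ {S x} → OnSide (complement S) x → code S x ≡ false
  code-off {S} {x} (odd-in ox Sx)   rewrite ox | not-injective Sx = ∧-zeroʳ (star A x)
  code-off {S} {x} (even-out ox Sx) rewrite ox | Sx = ∧-zeroʳ (star A x)

  code-elim : ∀ S x → code S x ≡ true → star A x ≡ true × OnSide S x
  code-elim S x cx with star A x | isOdd x in ox | S x in Sx
  ... | true | true  | true  = refl , odd-in ox Sx
  ... | true | false | false = refl , even-out ox Sx

  side-injective : ∀ b {s s′} → (if b then s else not s) ≡ (if b then s′ else not s′) → s ≡ s′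
  side-injective true  eq = eq
  side-injective false eq = not-injective eq

  star-intro : ∀ {x} → black A x ≡ false → white A x ≡ false → star A x ≡ true
  star-intro bx wx rewrite bx | wx = refl

  star-elim : ∀ x → star A x ≡ true → black A x ≡ false × white A x ≡ false
  star-elim x sx with black A x | white A x
  ... | false | false = refl , refl

  star-out : ∀ x → star A x ≡ false → black A x ≡ true ⊎ white A x ≡ true
  star-out x sx with black A x | white A x
  ... | true  | _     = inj₁ refl
  ... | false | true  = inj₂ refl

  black-near-star : ∀ {x y} → star A x ≡ true → y ∈ neighbours x → black A y ≡ true → isOdd y ≡ true
  black-near-star {x} {y} sx y∈ by =
    odd-vertex y (blackOdd A y x by (adjacent-sym x y y∈) (proj₁ (star-elim x sx)))

  white-near-star : ∀ {x y} → star A x ≡ true → y ∈ neighbours x → white A y ≡ true → isOdd y ≡ false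
  white-near-star {x} {y} sx y∈ wy =
    even-vertex y (whiteEven A y x wy (adjacent-sym x y y∈) (proj₂ (star-elim x sx)))

  odd-end-on-side : ∀ {S u w} → OddSet S → w ∈ neighbours u → isOdd u ≡ true → OnSide S u ⊎ OnSide S w
  odd-end-on-side {S} {u} {w} oddS w∈ ou with bool-cases (S u) | bool-cases (S w)
  ... | inj₁ Su | _       = inj₁ (odd-in ou Su)
  ... | inj₂ Su | inj₂ Sw = inj₂ (even-out ow Sw)
    where ow = trans (adjacent-parity u w w∈) (cong not ou)
  ... | inj₂ Su | inj₁ Sw = ⊥-elim (true≢false (trans (sym w-odd) (trans (adjacent-parity u w w∈) (cong not ou))))
    where w-odd = odd-vertex w (oddS w u Sw (adjacent-sym u w w∈) Su)

  edge-on-side : ∀ {S x y} → OddSet S → y ∈ neighbours x → OnSide S x ⊎ OnSide S y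
  edge-on-side {S} {x} {y} oddS y∈ with bool-cases (isOdd x)
  ... | inj₁ ox = odd-end-on-side oddS y∈ ox
  ... | inj₂ ox = swap (odd-end-on-side oddS (adjacent-sym x y y∈) (trans (adjacent-parity x y y∈) (cong not ox)))

  not-isolated : ∀ {U : Subset d} {x} → NoIsolatedInside U → x ∈S U →
    ¬ ¬ (Σ (Vertex d) λ y → y ∈ neighbours x × y ∈S U)
  not-isolated {x = x} no-isolated xU ¬found =
    no-isolated (x , xU , All.tabulate (λ {y} y∈ → ≢⇒not true (λ yU → ¬found (y , y∈ , yU))))

  off-side-neighbour : ∀ {S x} → Admissible S → star A x ≡ true → OnSide S x →
    ¬ ¬ (Σ (Vertex d) λ y → y ∈ neighbours x × star A y ≡ true × OnSide (complement S) y)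
  off-side-neighbour {S} {x} ((in-regular , _) , _ , _ , white⊆Sᶜ) sx (odd-in ox Sx) found =
    not-isolated in-regular Sx λ (y , y∈ , Sy) →
      let oy = trans (adjacent-parity x y y∈) (cong not ox)
          by = ≢⇒not true (λ b → true≢false (trans (sym (black-near-star sx y∈ b)) oy))
          wy = ≢⇒not true (λ w → true≢false (trans (sym Sy) (white⊆Sᶜ y w)))
      in found (y , y∈ , star-intro by wy , even-out oy (cong not Sy))
  off-side-neighbour {S} {x} ((_ , out-regular) , _ , black⊆S , _) sx (even-out ox Sx) found =
    not-isolated out-regular (cong not Sx) λ (y , y∈ , Sy) →
      let oy = trans (adjacent-parity x y y∈) (cong not ox)
          wy = ≢⇒not true (λ w → true≢false (trans (sym oy) (white-near-star sx y∈ w)))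
          by = ≢⇒not true (λ b → true≢false (trans (sym Sy) (cong not (black⊆S y b))))
      in found (y , y∈ , star-intro by wy , odd-in oy Sy)

  code-minimal-cover : ∀ {S} → Admissible S → IsMinimalCover (code S)
  code-minimal-cover {S} adm@(_ , oddS , _) = record
    { covers  = λ x y (y∈ , sx , sy) → Data.Sum.map (code-on sx) (code-on sy) (edge-on-side oddS y∈)
    ; minimal = λ x cx found → let (sx , on) = code-elim S x cx in
        off-side-neighbour adm sx on λ (y , y∈ , sy , off) → found (y , (y∈ , sx , sy) , code-off off)
    }

  -- S is determined by C(S): outside A* by the approximation, on A* by the code.
  code-injective : ∀ {S T} → Approximates A S → Approximates A T →
    (∀ x → code S x ≡ code T x) → ∀ x → S x ≡ T x
  code-injective {S} {T} (black⊆S , white⊆Sᶜ) (black⊆T , white⊆Tᶜ) same x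
    with bool-cases (black A x) | bool-cases (white A x)
  ... | inj₁ bx | _       = trans (black⊆S x bx) (sym (black⊆T x bx))
  ... | inj₂ _  | inj₁ wx = trans (white⊆Sᶜ x wx) (sym (white⊆Tᶜ x wx))
  ... | inj₂ bx | inj₂ wx = side-injective (isOdd x)
        (trans (sym (cong (_∧ side S x) sx)) (trans (same x) (cong (_∧ side T x) sx)))
    where sx = star-intro bx wx

  code-boundary : ∀ {S x y} → Approximates A S → code S x ≡ true → y ∈ neighbours x →
    star A y ≡ false → S x ≢ S y
  code-boundary {S} {x} {y} (black⊆S , white⊆Sᶜ) cx y∈ sy with code-elim S x cx | star-out y sy
  ... | sx , odd-in ox Sx   | inj₁ by = λ _ → true≢false
        (trans (sym (black-near-star sx y∈ by)) (trans (adjacent-parity x y y∈) (cong not ox)))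
  ... | sx , odd-in ox Sx   | inj₂ wy = λ eq → true≢false (trans (sym Sx) (trans eq (white⊆Sᶜ y wy)))
  ... | sx , even-out ox Sx | inj₁ by = λ eq → true≢false (trans (sym (black⊆S y by)) (trans (sym eq) Sx))
  ... | sx , even-out ox Sx | inj₂ wy = λ _ → true≢false
        (trans (sym (trans (adjacent-parity x y y∈) (cong not ox))) (white-near-star sx y∈ wy))

module EdgeCount {d : ℕ} (A : Approximation d) where
  open Code A

  Joins : Edge d → Vertex d → Vertex d → Set
  Joins (z , i) x y = (z ≡ x × z +e i ≡ y) ⊎ (z ≡ y × z +e i ≡ x)

  incidence : Vertex d → Fin d → List (Vertex d × Edge d)
  incidence x i = (x +e i , (x , i)) ∷ (x -e i , (x -e i , i)) ∷ []

  incidences : Vertex d → List (Vertex d × Edge d)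
  incidences x = concatMap (incidence x) (allFin d)

  exits : Vertex d → List (Edge d)
  exits x = List.map proj₂ (filterᵇ (not ∘ star A ∘ proj₁) (incidences x))

  incidence-joins : ∀ x y e → (y , e) ∈ incidences x → y ∈ neighbours x × Joins e x y
  incidence-joins x y e ∈inc = go (allFin d) (∈-concatMap⁻ (incidence x) {xs = allFin d} ∈inc)
    where
    go : ∀ is → Any (λ i → (y , e) ∈ incidence x i) is → y ∈ neighbours x × Joins e x y
    go (i ∷ is) (here (here refl))         = +e-neighbour x i , inj₁ (refl , refl)
    go (i ∷ is) (here (there (here refl))) = -e-neighbour x i , inj₂ (refl , -e+e x i)
    go (i ∷ is) (there any)                = go is any

  unique-incident-edges : ∀ x → Unique (List.map proj₂ (incidences x))
  unique-incident-edges x =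
    subst Unique (sym (map-concatMap proj₂ (incidence x) (allFin d)))
      (unique-concatMap {P = λ _ → ⊤} (List.map proj₂ ∘ incidence x) (UniqueP.allFin⁺ d)
        (All.universal (λ _ → tt) (allFin d))
        (λ {i} _ → block-unique i) (λ _ _ → same-direction))
    where
    -- (x , i) ≠ (x − e_i , i) because x ≠ x − e_i.
    block-unique : ∀ i → Unique (List.map proj₂ (incidence x i))
    block-unique i = ((λ eq → ≢-e x i (cong proj₁ eq)) ∷ []) ∷ [] ∷ []
    -- Edges coming from different directions differ in their direction.
    direction : ∀ {i e} → e ∈ List.map proj₂ (incidence x i) → proj₂ e ≡ i
    direction (here refl)         = refl
    direction (there (here refl)) = refl
    same-direction : ∀ {i j e} → e ∈ List.map proj₂ (incidence x i) → e ∈ List.map proj₂ (incidence x j) →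
      i ≡ j
    same-direction e∈i e∈j = trans (sym (direction e∈i)) (direction e∈j)

  unique-exits : ∀ x → Unique (exits x)
  unique-exits x = unique-map-filter proj₂ (not ∘ star A ∘ proj₁) (incidences x) (unique-incident-edges x)

  exit-outside : ∀ x e → e ∈ exits x →
    Σ (Vertex d) λ y → y ∈ neighbours x × star A y ≡ false × Joins e x y
  exit-outside x e e∈ with ∈-map⁻ proj₂ e∈
  ... | (y , e) , ∈filtered , refl with ∈-filter⁻ (T? ∘ not ∘ star A ∘ proj₁) {xs = incidences x} ∈filtered
  ... | ∈inc , outside = y , proj₁ (incidence-joins x y e ∈inc) , not-injective (T⇒true outside) ,
                         proj₂ (incidence-joins x y e ∈inc)

  -- An exit edge has exactly one endpoint in A*, so it determines its vertex in A*.
  exits-disjoint : ∀ {x x′ e} → star A x ≡ true → star A x′ ≡ true →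
    e ∈ exits x → e ∈ exits x′ → x ≡ x′
  exits-disjoint {x} {x′} {e} sx sx′ e∈ e∈′ with exit-outside x e e∈ | exit-outside x′ e e∈′
  ... | _ , _ , _  , inj₁ (z≡x , _) | _ , _ , _ , inj₁ (z≡x′ , _) = trans (sym z≡x) z≡x′
  ... | _ , _ , _  , inj₂ (_ , z+≡x) | _ , _ , _ , inj₂ (_ , z+≡x′) = trans (sym z+≡x) z+≡x′
  ... | _ , _ , _  , inj₁ (z≡x , _) | _ , _ , sy′ , inj₂ (z≡y′ , _) =
        ⊥-elim (true≢false (trans (sym sx) (trans (cong (star A) (trans (sym z≡x) z≡y′)) sy′)))
  ... | _ , _ , sy , inj₂ (z≡y , _) | _ , _ , _ , inj₁ (z≡x′ , _) =
        ⊥-elim (true≢false (trans (sym sx′) (trans (cong (star A) (trans (sym z≡x′) z≡y)) sy)))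

  -- A vertex of A* has at most t neighbours in A*, hence at least 2d − t exits.
  length-exits : ∀ {t x} → IsTApproximation t A → star A x ≡ true → 2 * d ∸ t ≤ length (exits x)
  length-exits {t} {x} tA sx = begin
    2 * d ∸ t                          ≤⟨ ∸-monoʳ-≤ (2 * d) (proj₂ (tA x sx)) ⟩
    2 * d ∸ inside                     ≤⟨ ∸-monoˡ-≤ inside (length-neighbours x) ⟩
    length (neighbours x) ∸ inside     ≡⟨ cong (_∸ inside) (sym split) ⟩
    (inside + outside) ∸ inside        ≡⟨ m+n∸m≡n inside outside ⟩
    outside                            ≡⟨ sym exits-outside ⟩
    length (exits x)                   ∎
    where
    open ≤-Reasoning
    inside outside : ℕ
    inside  = length (filterᵇ (star A) (neighbours x))
    outside = length (filterᵇ (not ∘ star A) (neighbours x))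
    split : inside + outside ≡ length (neighbours x)
    split = length-filter-split (star A) (neighbours x)
    outgoing : List (Vertex d × Edge d)
    outgoing = filterᵇ (not ∘ star A ∘ proj₁) (incidences x)
    neighbours-incidences : List.map proj₁ (incidences x) ≡ neighbours x
    neighbours-incidences = map-concatMap proj₁ (incidence x) (allFin d)
    exits-outside : length (exits x) ≡ outside
    exits-outside = begin-equality
      length (exits x)                                                  ≡⟨ length-map proj₂ outgoing ⟩
      length outgoing                                                   ≡⟨ length-filter-map proj₁ (not ∘ star A) (incidences x) ⟩
      length (filterᵇ (not ∘ star A) (List.map proj₁ (incidences x)))   ≡⟨ cong (length ∘ filterᵇ (not ∘ star A)) neighbours-incidences ⟩
      outside                                                           ∎

  exit-in-boundary : ∀ {S x e} → Approximates A S → code S x ≡ true → e ∈ exits x → InBoundary S e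
  exit-in-boundary {S} {x} {e} approx cx e∈ with exit-outside x e e∈
  ... | y , y∈ , sy , inj₁ (refl , refl) = code-boundary approx cx y∈ sy
  ... | y , y∈ , sy , inj₂ (refl , refl) = code-boundary approx cx y∈ sy ∘ sym

  -- The exits of the vertices of C(S) are distinct edges of ∂S: (2d − t) · |C(S)| ≤ |∂S|.
  code-size : ∀ {t n S} → IsTApproximation t A → Admissible S → BoundarySize S n →
    ∀ P → Unique P → Contains (code S) P → (2 * d ∸ t) * length P ≤ n
  code-size {t} {n} {S} tA (_ , _ , approx) (B , _ , |B|≡n , B⇔∂S) P uP P⊆C = begin
    (2 * d ∸ t) * length P       ≤⟨ length-concatMap-≥ _ exits P (All.map (length-exits tA) P⊆A*) ⟩
    length (concatMap exits P)   ≤⟨ unique-⊆-length _ B distinct-exits exits⊆B ⟩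
    length B                     ≡⟨ |B|≡n ⟩
    n                            ∎
    where
    open ≤-Reasoning
    P⊆A* : All (λ x → star A x ≡ true) P
    P⊆A* = All.map (λ {x} cx → proj₁ (code-elim S x cx)) P⊆C
    distinct-exits : Unique (concatMap exits P)
    distinct-exits = unique-concatMap exits uP P⊆A* (λ {x} _ → unique-exits x) exits-disjoint
    exits⊆B : All (_∈ B) (concatMap exits P)
    exits⊆B = AllP.concat⁺ (AllP.map⁺ (All.map (λ cx → All.tabulate (λ {e} e∈ →
                Equivalence.from (B⇔∂S e) (exit-in-boundary approx cx e∈))) P⊆C))

≤-quotient : ∀ m .{{_ : NonZero m}} L n → m * L ≤ n → L ≤ n / m
≤-quotient m L n mL≤n =
  subst (_≤ n / m) (m*n/n≡m L m) (/-monoˡ-≤ m (subst (_≤ n) (*-comm m L) mL≤n))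

Counted : ∀ {d} → ℕ → Approximation d → Subset d → Set
Counted n A S = Regular S × OddSet S × BoundarySize S n × Approximates A S

-- There are at most 2^⌊n/(2d−t)⌋ such sets: their codes are distinct minimal covers
-- of the graph on A* with at most ⌊n/(2d−t)⌋ elements each.
count-approximated-sets : ∀ {d t} n (A : Approximation d) → IsTApproximation t A →
  .{{_ : NonZero (2 * d ∸ t)}} → (Ss : List (Subset d)) →
  AllPairs (λ S T → ¬ (∀ x → S x ≡ T x)) Ss → All (Counted n A) Ss →
  length Ss ≤ 2 ^ (n / (2 * d ∸ t))
count-approximated-sets {d} {t} n A tA Ss distinct members =
  subst (_≤ 2 ^ r) (length-map code Ss)
    (minimal-covers-≤ r (List.map code Ss)
      (AllPairsP.map⁺ (allPairs-restrict distinct-codes members distinct))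
      (AllP.map⁺ (All.map small-minimal-cover members)))
  where
  open Code A
  open EdgeCount A
  r : ℕ
  r = n / (2 * d ∸ t)
  distinct-codes : ∀ {S T} → Counted n A S → Counted n A T →
    ¬ (∀ x → S x ≡ T x) → Distinct (code S) (code T)
  distinct-codes (_ , _ , _ , approxS) (_ , _ , _ , approxT) S≠T same = S≠T (code-injective approxS approxT same)
  small-minimal-cover : ∀ {S} → Counted n A S → IsMinimalCover (code S) × HasAtMost r (code S)
  small-minimal-cover (reg , odd , ∂S , approx) =
    code-minimal-cover (reg , odd , approx) ,
    λ P uP P⊆C → ≤-quotient (2 * d ∸ t) (length P) n (code-size tA (reg , odd , approx) ∂S P uP P⊆C)

-- Proposition 4.2: N^(2d−t) ≤ 2^n, where N is the number of regular odd sets S with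
-- |∂S| = n approximated by the t-approximation A.
proposition4p2 : (d : ℕ) → 2 ≤ d → (n t : ℕ) → 1 ≤ n → 1 ≤ t → t < 2 * d →
    (A : Approximation d) → IsTApproximation t A →
    (Ss : List (Subset d)) →
    AllPairs (λ S T → ¬ (∀ x → S x ≡ T x)) Ss →
    All (λ S → Regular S × OddSet S × BoundarySize S n × Approximates A S) Ss →
    length Ss ^ (2 * d ∸ t) ≤ 2 ^ n
proposition4p2 d _ n t _ _ t<2d A tA Ss distinct members = begin
  length Ss ^ m       ≤⟨ ^-monoˡ-≤ m (count-approximated-sets n A tA Ss distinct members) ⟩
  (2 ^ (n / m)) ^ m   ≡⟨ ^-*-assoc 2 (n / m) m ⟩
  2 ^ (n / m * m)     ≤⟨ ^-monoʳ-≤ 2 (m/n*n≤m n m) ⟩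
  2 ^ n               ∎
  where
  open ≤-Reasoning
  m : ℕ
  m = 2 * d ∸ t
  instance
    m≢0 : NonZero m
    m≢0 = >-nonZero (m<n⇒0<n∸m t<2d)
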